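{- Let $\mathbb{F}_q$ be the finite field with $q$ elements, and let $A,B\subset\mathbb{F}_q$ satisfy $|A||B|>q$. Then there is $\xi\in\mathbb{F}_q^{*}$ such that $|A+\xi B|>\frac{q}{2}$ and $|A-\xi B|>\frac{q}{2}$.
   Context: $\mathbb{F}_q^*=\mathbb{F}_q\setminus\{0\}$. For $X,Y\subset\mathbb{F}_q$ and $\xi\in\mathbb{F}_q$, $X+\xi Y=\{x+\xi y:x\in X,y\in Y\}$ and $X-\xi Y=\{x-\xi y:x\in X,y\in Y\}$. -}

module Defs where

open import Data.Nat using (ℕ)
open import Data.Fin using (Fin)
open import Data.Fin.Properties using (any?; _≟_)
open import Data.Fin.Subset using (Subset; _∈_)
open import Data.Fin.Subset.Properties using (_∈?_)
open import Data.Vec using (tabulate)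
open import Data.Product using (∃; _×_; Σ)
open import Relation.Nullary using (¬_; does)
open import Relation.Nullary.Decidable using (_×-dec_)
open import Relation.Binary.PropositionalEquality using (_≡_)
open import Algebra.Structures using (IsCommutativeRing)

-- A finite field with q elements, presented (up to isomorphism) on the
-- carrier Fin q with propositional equality: a commutative ring with
-- 0 ≠ 1 in which every nonzero element has a multiplicative inverse.
record FiniteField (q : ℕ) : Set where
  field
    _+_ _*_ : Fin q → Fin q → Fin q
    -_      : Fin q → Fin q
    0# 1#   : Fin q
    isCommutativeRing : IsCommutativeRing _≡_ _+_ _*_ -_ 0# 1#
    0≢1     : ¬ (0# ≡ 1#)
    inverse : ∀ x → ¬ (x ≡ 0#) → Σ (Fin q) λ y → (x * y) ≡ 1#

image₂ : ∀ {q} → (Fin q → Fin q → Fin q) → Subset q → Subset q → Subset q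
image₂ op A B = tabulate λ z →
  does (any? λ x → any? λ y → (x ∈? A) ×-dec ((y ∈? B) ×-dec (op x y ≟ z)))

_+[_]_ : ∀ {q} (F : FiniteField q) → Fin q → Subset q → Subset q → Subset q
(F +[ ξ ] X) Y = image₂ (λ x y → x + (ξ * y)) X Y
  where open FiniteField F

_-[_]_ : ∀ {q} (F : FiniteField q) → Fin q → Subset q → Subset q → Subset q
(F -[ ξ ] X) Y = image₂ (λ x y → x + (- (ξ * y))) X Y
  where open FiniteField F

module Submission where

-- For a slope ξ let E(ξ) be the additive energy of A + ξB: the number of
-- quadruples (a, b, a', b') ∈ (A × B)² with a + ξb = a' + ξb'.  Cauchy–
-- Schwarz gives (|A||B|)² ≤ |A + ξB| · E(ξ), and exchanging b with b'
-- shows that A - ξB has the same energy, so it suffices to find ξ ≠ 0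
-- with q · E(ξ) < 2(|A||B|)².  For a fixed quadruple, the lines
-- ξ ↦ a + ξb and ξ ↦ a' + ξb' meet at most once unless b = b', which
-- bounds ∑_{ξ≠0} E(ξ) by (|A|² - |A|)(|B|² - |B|) + (q - 1)|A||B|; when
-- |A||B| > q this is less than (q - 1) · 2(|A||B|)²/q, so some ξ ≠ 0 works.

open import Defs
open import Data.Nat using (ℕ; _*_; _<_)
open import Data.Fin using (Fin)
open import Data.Fin.Subset using (Subset; ∣_∣)
open import Data.Product using (Σ; _×_)
open import Relation.Nullary using (¬_)
open import Relation.Binary.PropositionalEquality using (_≡_)

module Indicators where

  open import Level using (Level)
  open import Data.Nat using (_+_; _≤_; z≤n; s≤s)
  open import Data.Nat.Properties using (*-identityˡ; +-monoˡ-≤)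
  open import Data.Bool using (if_then_else_)
  open import Data.Fin.Properties using (_≟_)
  open import Data.Fin.Subset.Properties using (_∈?_)
  open import Data.Empty using (⊥-elim)
  open import Relation.Nullary using (Dec; does; yes; no; ¬?)
  open import Relation.Binary.PropositionalEquality using (refl; sym; trans)

  private variable
    ℓ ℓ′ : Level
    P : Set ℓ
    Q : Set ℓ′

  𝟙 : Dec P → ℕ
  𝟙 d = if does d then 1 else 0

  𝟙≤1 : (d : Dec P) → 𝟙 d ≤ 1
  𝟙≤1 (yes _) = s≤s z≤n
  𝟙≤1 (no _)  = z≤n

  𝟙-yes : P → (d : Dec P) → 𝟙 d ≡ 1
  𝟙-yes _ (yes _)  = refl
  𝟙-yes p (no ¬p)  = ⊥-elim (¬p p)

  𝟙-no : ¬ P → (d : Dec P) → 𝟙 d ≡ 0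
  𝟙-no ¬p (yes p) = ⊥-elim (¬p p)
  𝟙-no _  (no _)  = refl

  𝟙≡1⇒ : (d : Dec P) → 𝟙 d ≡ 1 → P
  𝟙≡1⇒ (yes p) _ = p
  𝟙≡1⇒ (no _) ()

  𝟙-idem : (d : Dec P) → 𝟙 d * 𝟙 d ≡ 𝟙 d
  𝟙-idem (yes _) = refl
  𝟙-idem (no _)  = refl

  𝟙-¬ : (d : Dec P) → 𝟙 (¬? d) + 𝟙 d ≡ 1
  𝟙-¬ (yes _) = refl
  𝟙-¬ (no _)  = refl

  𝟙-cong : (P → Q) → (Q → P) → (d : Dec P) (e : Dec Q) → 𝟙 d ≡ 𝟙 e
  𝟙-cong _   _   (yes _) (yes _) = refl
  𝟙-cong _   _   (no _)  (no _)  = refl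
  𝟙-cong P→Q _   (yes p) (no ¬q) = ⊥-elim (¬q (P→Q p))
  𝟙-cong _   Q→P (no ¬p) (yes q) = ⊥-elim (¬p (Q→P q))

  𝟙-absorb : ∀ {t : ℕ} (d : Dec P) → (¬ P → t ≡ 0) → t ≡ 𝟙 d * t
  𝟙-absorb {t = t} (yes _) _ = sym (*-identityˡ t)
  𝟙-absorb (no ¬p) t≡0       = t≡0 ¬p

  𝟙-guard : ∀ {t : ℕ} (d : Dec P) → (P → t ≡ 0) → 𝟙 d * t ≡ 0
  𝟙-guard {t = t} (yes p) t≡0 = trans (*-identityˡ t) (t≡0 p)
  𝟙-guard         (no _)  _   = refl

  𝟙-weighted-≤ : ∀ {s t : ℕ} → (P → s ≤ t) → (d : Dec P) → 𝟙 d * s ≤ 𝟙 d * t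
  𝟙-weighted-≤ s≤t (yes p) = +-monoˡ-≤ 0 (s≤t p)
  𝟙-weighted-≤ _   (no _)  = z≤n

  δ : ∀ {n} → Fin n → Fin n → ℕ
  δ i j = 𝟙 (i ≟ j)

  δᶜ : ∀ {n} → Fin n → Fin n → ℕ
  δᶜ i j = 𝟙 (¬? (i ≟ j))

  δ-sym : ∀ {n} (i j : Fin n) → δ i j ≡ δ j i
  δ-sym i j = 𝟙-cong sym sym (i ≟ j) (j ≟ i)

  χ : ∀ {n} → Subset n → Fin n → ℕ
  χ P x = 𝟙 (x ∈? P)

module FiniteSums where

  open import Data.Nat using (zero; suc; _+_; _≤_; z≤n; s≤s)
  open import Data.Nat.Properties
    using (+-*-semiring; +-mono-≤; +-identityʳ; *-identityˡ; *-distribʳ-+; m≤m+n; m≤n+m;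
           ≤-trans; ≤-reflexive)
  open import Data.Fin using (zero; suc)
  open import Data.Fin.Properties using (suc-injective; _≟_)
  open import Data.Fin.Subset using (inside; outside)
  open import Data.Vec using (_∷_; [])
  open import Function using (_∘_)
  open import Relation.Binary.PropositionalEquality using (refl; sym; trans; cong; cong₂)
  open Indicators

  private variable m n : ℕ

  open import Algebra.Properties.Semiring.Sum +-*-semiring public
    using (sum; sum-syntax; ∑-comm; ∑-distrib-+; sum-cong-≗)
  open import Algebra.Properties.Semiring.Sum +-*-semiring
    using (*-distribˡ-sum; *-distribʳ-sum; sum-replicate-zero)

  ∑-mono : ∀ {n} {f g : Fin n → ℕ} → (∀ i → f i ≤ g i) → sum f ≤ sum g
  ∑-mono {zero}  _   = z≤n
  ∑-mono {suc n} f≤g = +-mono-≤ (f≤g zero) (∑-mono (f≤g ∘ suc))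

  ∑-zero : ∀ {n} (f : Fin n → ℕ) → (∀ i → f i ≡ 0) → sum f ≡ 0
  ∑-zero {n} f f≡0 = trans (sum-cong-≗ f≡0) (sum-replicate-zero n)

  ∑-ones : ∀ n → ∑[ i < n ] 1 ≡ n
  ∑-ones zero    = refl
  ∑-ones (suc n) = cong suc (∑-ones n)

  ∑-term : ∀ {n} (f : Fin n → ℕ) i → f i ≤ sum f
  ∑-term f zero    = m≤m+n (f zero) _
  ∑-term f (suc i) = ≤-trans (∑-term (f ∘ suc) i) (m≤n+m _ (f zero))

  *-∑ : ∀ {n} c (f : Fin n → ℕ) → c * sum f ≡ ∑[ i < n ] (c * f i)
  *-∑ = *-distribˡ-sum

  ∑-* : ∀ {n} c (f : Fin n → ℕ) → sum f * c ≡ ∑[ i < n ] (f i * c)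
  ∑-* = *-distribʳ-sum

  ∑-product : ∀ {m n} (f : Fin m → ℕ) (g : Fin n → ℕ) →
    sum f * sum g ≡ ∑[ i < m ] ∑[ j < n ] (f i * g j)
  ∑-product f g = trans (∑-* (sum g) f) (sum-cong-≗ λ i → *-∑ (f i) g)

  ∑-δ : ∀ {n} (i : Fin n) (f : Fin n → ℕ) → ∑[ j < n ] (δ i j * f j) ≡ f i
  ∑-δ {suc n} zero f = trans (cong₂ _+_ (*-identityˡ (f zero)) rest-vanishes) (+-identityʳ (f zero))
    where
    rest-vanishes : ∑[ j < n ] (δ zero (suc j) * f (suc j)) ≡ 0
    rest-vanishes = ∑-zero (λ j → δ zero (suc j) * f (suc j)) λ _ → refl
  ∑-δ (suc i) f      = ∑-δ i (f ∘ suc)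

  ∑-at-most-one : ∀ {n} (f : Fin n → ℕ) → (∀ i → f i ≤ 1) →
    (∀ i j → f i ≡ 1 → f j ≡ 1 → i ≡ j) → sum f ≤ 1
  ∑-at-most-one {zero}  _ _   _    = z≤n
  ∑-at-most-one {suc n} f f≤1 once with f zero in f0 | f≤1 zero
  ... | zero        | _      = ∑-at-most-one (f ∘ suc) (f≤1 ∘ suc)
                                 (λ i j fi fj → suc-injective (once (suc i) (suc j) fi fj))
  ... | suc zero    | _      = s≤s (≤-reflexive (∑-zero (f ∘ suc) vanish))
    where
    -- the value 1 is already taken at zero
    vanish : ∀ i → f (suc i) ≡ 0
    vanish i with f (suc i) in fi | f≤1 (suc i)
    ... | zero        | _ = refl
    ... | suc zero    | _ with () ← once zero (suc i) f0 fi
    ... | suc (suc _) | s≤s ()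
  ... | suc (suc _) | s≤s ()

  card : ∀ {n} (P : Subset n) → ∣ P ∣ ≡ sum (χ P)
  card []            = refl
  card (inside ∷ P)  = cong suc (card P)
  card (outside ∷ P) = card P

  ∑₂ : ∀ {m n} → (Fin m → Fin n → ℕ) → ℕ
  ∑₂ {m} {n} f = ∑[ i < m ] ∑[ j < n ] f i j

  ∑₂-cong : {f g : Fin m → Fin n → ℕ} → (∀ i j → f i j ≡ g i j) → ∑₂ f ≡ ∑₂ g
  ∑₂-cong f≡g = sum-cong-≗ λ i → sum-cong-≗ (f≡g i)

  ∑₂-mono : {f g : Fin m → Fin n → ℕ} → (∀ i j → f i j ≤ g i j) → ∑₂ f ≤ ∑₂ g
  ∑₂-mono f≤g = ∑-mono λ i → ∑-mono (f≤g i)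

  *-∑₂ : ∀ c (f : Fin m → Fin n → ℕ) → c * ∑₂ f ≡ ∑₂ λ i j → c * f i j
  *-∑₂ c f = trans (*-∑ c λ i → sum (f i)) (sum-cong-≗ λ i → *-∑ c (f i))

  ∑₂-distrib-+ : (f g : Fin m → Fin n → ℕ) → ∑₂ (λ i j → f i j + g i j) ≡ ∑₂ f + ∑₂ g
  ∑₂-distrib-+ f g = trans (sum-cong-≗ λ i → ∑-distrib-+ (f i) (g i))
                           (∑-distrib-+ (λ i → sum (f i)) (λ i → sum (g i)))

  ∑-∑₂ : ∀ {k} (f : Fin k → Fin m → Fin n → ℕ) →
    ∑[ z < k ] ∑₂ (f z) ≡ ∑₂ λ i j → ∑[ z < k ] f z i j
  ∑-∑₂ f = trans (∑-comm λ z i → sum (f z i)) (sum-cong-≗ λ i → ∑-comm λ z j → f z i j)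

  ∑₂-product : ∀ {k l} (f : Fin m → Fin n → ℕ) (g : Fin k → Fin l → ℕ) →
    ∑₂ f * ∑₂ g ≡ ∑₂ λ i j → ∑₂ λ i' j' → f i j * g i' j'
  ∑₂-product f g = trans (∑-* (∑₂ g) λ i → sum (f i)) (sum-cong-≗ λ i →
    trans (∑-* (∑₂ g) (f i)) (sum-cong-≗ λ j → *-∑₂ (f i j) g))

  ∑₂-diagonal : ∀ {n} (f : Fin n → Fin n → ℕ) → ∑₂ (λ i j → δ i j * f i j) ≡ ∑[ i < n ] f i i
  ∑₂-diagonal f = sum-cong-≗ λ i → ∑-δ i (f i)

  ∑₂-split-diagonal : ∀ {n} (f : Fin n → Fin n → ℕ) →
    ∑₂ (λ i j → δᶜ i j * f i j) + ∑₂ (λ i j → δ i j * f i j) ≡ ∑₂ f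
  ∑₂-split-diagonal {n} f =
    trans (sym (∑₂-distrib-+ (λ i j → δᶜ i j * f i j) (λ i j → δ i j * f i j))) (∑₂-cong λ i j →
      trans (sym (*-distribʳ-+ (f i j) (δᶜ i j) (δ i j)))
            (trans (cong (_* f i j) (𝟙-¬ (_≟_ {n} i j))) (*-identityˡ (f i j))))

  ∑₄ : ∀ {m n} → (Fin m → Fin n → Fin m → Fin n → ℕ) → ℕ
  ∑₄ f = ∑₂ λ a b → ∑₂ λ a' b' → f a b a' b'

  ∑₄-cong : {f g : Fin m → Fin n → Fin m → Fin n → ℕ} →
    (∀ a b a' b' → f a b a' b' ≡ g a b a' b') → ∑₄ f ≡ ∑₄ g
  ∑₄-cong f≡g = ∑₂-cong λ a b → ∑₂-cong (f≡g a b)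

  ∑₄-mono : {f g : Fin m → Fin n → Fin m → Fin n → ℕ} →
    (∀ a b a' b' → f a b a' b' ≤ g a b a' b') → ∑₄ f ≤ ∑₄ g
  ∑₄-mono f≤g = ∑₂-mono λ a b → ∑₂-mono (f≤g a b)

  *-∑₄ : ∀ c (f : Fin m → Fin n → Fin m → Fin n → ℕ) →
    c * ∑₄ f ≡ ∑₄ λ a b a' b' → c * f a b a' b'
  *-∑₄ c f = trans (*-∑₂ c λ a b → ∑₂ (f a b)) (∑₂-cong λ a b → *-∑₂ c (f a b))

  ∑₄-distrib-+ : (f g : Fin m → Fin n → Fin m → Fin n → ℕ) →
    ∑₄ (λ a b a' b' → f a b a' b' + g a b a' b') ≡ ∑₄ f + ∑₄ g
  ∑₄-distrib-+ f g = trans (∑₂-cong λ a b → ∑₂-distrib-+ (f a b) (g a b))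
                           (∑₂-distrib-+ (λ a b → ∑₂ (f a b)) (λ a b → ∑₂ (g a b)))

  ∑-∑₄ : ∀ {k} (f : Fin k → Fin m → Fin n → Fin m → Fin n → ℕ) →
    ∑[ z < k ] ∑₄ (f z) ≡ ∑₄ λ a b a' b' → ∑[ z < k ] f z a b a' b'
  ∑-∑₄ f = trans (∑-∑₂ λ z a b → ∑₂ (f z a b)) (∑₂-cong λ a b → ∑-∑₂ λ z → f z a b)

  ∑₄-factor : (f : Fin m → Fin m → ℕ) (g : Fin n → Fin n → ℕ) →
    ∑₄ (λ a b a' b' → f a a' * g b b') ≡ ∑₂ f * ∑₂ g
  ∑₄-factor f g = sym (trans (∑₂-product f g) (sum-cong-≗ λ a →
    ∑-comm λ a' b → sum λ b' → f a a' * g b b'))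

  ∑₄-swap : (f : Fin m → Fin n → Fin m → Fin n → ℕ) →
    ∑₄ f ≡ ∑₄ λ a b a' b' → f a b' a' b
  ∑₄-swap f = sum-cong-≗ λ a → sym (trans
    (sum-cong-≗ λ b → ∑-comm λ a' b' → f a b' a' b)
    (trans (∑-comm λ b b' → sum λ a' → f a b' a' b)
           (sum-cong-≗ λ b' → ∑-comm λ b a' → f a b' a' b)))

-- The Cauchy–Schwarz inequality for natural-number vectors, proved by
-- expanding (∑ fᵢgᵢ)² as a double sum and applying 2xy ≤ x² + y² to
-- each pair of indices.
module CauchySchwarz where

  open import Data.Nat using (zero; suc; _+_; _≤_; z≤n)
  open import Data.Nat.Properties using (*-zeroʳ; +-monoˡ-≤; *-cancelˡ-≤; ≤-reflexive; ≤-trans; module ≤-Reasoning)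
  open import Data.Nat.Tactic.RingSolver using (solve-∀)
  open import Relation.Binary.PropositionalEquality using (sym; cong; cong₂)
  open FiniteSums

  2xy≤x²+y² : ∀ x y → 2 * (x * y) ≤ x * x + y * y
  2xy≤x²+y² zero    y       = z≤n
  2xy≤x²+y² (suc x) zero    = ≤-trans (≤-reflexive (cong (2 *_) (*-zeroʳ (suc x)))) z≤n
  2xy≤x²+y² (suc x) (suc y) = begin
    2 * (suc x * suc y)               ≡⟨ expand-product x y ⟩
    2 * (x * y) + 2 * (1 + x + y)     ≤⟨ +-monoˡ-≤ _ (2xy≤x²+y² x y) ⟩
    x * x + y * y + 2 * (1 + x + y)   ≡⟨ expand-squares x y ⟩
    suc x * suc x + suc y * suc y     ∎
    where
    open ≤-Reasoning
    expand-product : ∀ x y → 2 * (suc x * suc y) ≡ 2 * (x * y) + 2 * (1 + x + y)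
    expand-product = solve-∀
    expand-squares : ∀ x y → x * x + y * y + 2 * (1 + x + y) ≡ suc x * suc x + suc y * suc y
    expand-squares = solve-∀

  cauchy-schwarz : ∀ {n} (f g : Fin n → ℕ) →
    (∑[ i < n ] (f i * g i)) * (∑[ i < n ] (f i * g i))
      ≤ (∑[ i < n ] (f i * f i)) * (∑[ i < n ] (g i * g i))
  cauchy-schwarz {n} f g = *-cancelˡ-≤ 2 (begin
    2 * (sum fg * sum fg)
      ≡⟨ cong (2 *_) (∑-product fg fg) ⟩
    2 * ∑₂ (λ i j → fg i * fg j)
      ≡⟨ *-∑₂ 2 (λ i j → fg i * fg j) ⟩
    ∑₂ (λ i j → 2 * (fg i * fg j))
      ≡⟨ ∑₂-cong (λ i j → regroup (f i) (g i) (f j) (g j)) ⟩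
    ∑₂ (λ i j → 2 * ((f i * g j) * (f j * g i)))
      ≤⟨ ∑₂-mono (λ i j → 2xy≤x²+y² (f i * g j) (f j * g i)) ⟩
    ∑₂ (λ i j → (f i * g j) * (f i * g j) + (f j * g i) * (f j * g i))
      ≡⟨ ∑₂-cong (λ i j → square-products (f i) (g i) (f j) (g j)) ⟩
    ∑₂ (λ i j → ff i * gg j + gg i * ff j)
      ≡⟨ ∑₂-distrib-+ (λ i j → ff i * gg j) (λ i j → gg i * ff j) ⟩
    ∑₂ (λ i j → ff i * gg j) + ∑₂ (λ i j → gg i * ff j)
      ≡⟨ sym (cong₂ _+_ (∑-product ff gg) (∑-product gg ff)) ⟩
    sum ff * sum gg + sum gg * sum ff
      ≡⟨ double (sum ff) (sum gg) ⟩
    2 * (sum ff * sum gg) ∎)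
    where
    open ≤-Reasoning
    fg ff gg : Fin n → ℕ
    fg i = f i * g i
    ff i = f i * f i
    gg i = g i * g i
    regroup : ∀ x y u v → 2 * ((x * y) * (u * v)) ≡ 2 * ((x * v) * (u * y))
    regroup = solve-∀
    square-products : ∀ x y u v → (x * v) * (x * v) + (u * y) * (u * y) ≡ (x * x) * (v * v) + (y * y) * (u * u)
    square-products = solve-∀
    double : ∀ s t → s * t + t * s ≡ 2 * (s * t)
    double = solve-∀

-- Since ∑ rep = |A||B|, ∑ rep² = energy and rep
-- vanishes off the image op(A, B), Cauchy–Schwarz gives
-- (|A||B|)² ≤ |op(A, B)| · energy op.
module AdditiveEnergy {n : ℕ} (A B : Subset n) where

  open import Data.Nat using (_≤_)
  open import Data.Nat.Properties using (module ≤-Reasoning)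
  open import Data.Nat.Tactic.RingSolver using (solve-∀)
  open import Data.Fin.Properties using (_≟_; any?)
  open import Data.Fin.Subset using (_∈_)
  open import Data.Fin.Subset.Properties using (_∈?_)
  open import Data.Vec.Properties using (lookup∘tabulate; lookup⇒[]=)
  open import Data.Product using (_,_)
  open import Data.Empty using (⊥-elim)
  open import Relation.Nullary using (Dec; yes; no)
  open import Relation.Nullary.Decidable using (dec-true; _×-dec_)
  open import Relation.Binary.PropositionalEquality using (refl; sym; trans; cong₂; module ≡-Reasoning)
  open Indicators
  open FiniteSums
  open CauchySchwarz

  Op : Set
  Op = Fin n → Fin n → Fin n

  weight : Fin n → Fin n → ℕ
  weight a b = χ A a * χ B b

  rep : Op → Fin n → ℕ
  rep op z = ∑₂ λ a b → δ (op a b) z * weight a b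

  energy : Op → ℕ
  energy op = ∑₄ λ a b a' b' → δ (op a b) (op a' b') * (weight a b * weight a' b')

  ∈-image₂ : ∀ op {a b} → a ∈ A → b ∈ B → op a b ∈ image₂ op A B
  ∈-image₂ op {a} {b} a∈A b∈B = lookup⇒[]= (op a b) (image₂ op A B)
    (trans (lookup∘tabulate _ (op a b)) (dec-true decision (a , b , a∈A , b∈B , refl)))
    where
    decision : Dec (Σ (Fin n) λ x → Σ (Fin n) λ y → x ∈ A × (y ∈ B × op x y ≡ op a b))
    decision = any? λ x → any? λ y → (x ∈? A) ×-dec ((y ∈? B) ×-dec (op x y ≟ op a b))

  module _ (op : Op) where

    ∑-rep : sum (rep op) ≡ ∣ A ∣ * ∣ B ∣
    ∑-rep = begin
      sum (rep op)                                       ≡⟨ ∑-∑₂ (λ z a b → δ (op a b) z * weight a b) ⟩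
      ∑₂ (λ a b → ∑[ z < n ] (δ (op a b) z * weight a b)) ≡⟨ ∑₂-cong (λ a b → ∑-δ (op a b) (λ _ → weight a b)) ⟩
      ∑₂ weight                                          ≡⟨ sym (∑-product (χ A) (χ B)) ⟩
      sum (χ A) * sum (χ B)                              ≡⟨ sym (cong₂ _*_ (card A) (card B)) ⟩
      ∣ A ∣ * ∣ B ∣                                      ∎
      where open ≡-Reasoning

    ∑-rep² : ∑[ z < n ] (rep op z * rep op z) ≡ energy op
    ∑-rep² = begin
      ∑[ z < n ] (rep op z * rep op z)
        ≡⟨ sum-cong-≗ (λ z → ∑₂-product (term z) (term z)) ⟩
      ∑[ z < n ] ∑₄ (λ a b a' b' → term z a b * term z a' b')
        ≡⟨ ∑-∑₄ (λ z a b a' b' → term z a b * term z a' b') ⟩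
      ∑₄ (λ a b a' b' → ∑[ z < n ] (term z a b * term z a' b'))
        ≡⟨ ∑₄-cong (λ a b a' b' → coincide (op a b) (op a' b') (weight a b) (weight a' b')) ⟩
      energy op ∎
      where
      open ≡-Reasoning
      term : Fin n → Fin n → Fin n → ℕ
      term z a b = δ (op a b) z * weight a b
      regroup : ∀ d e x y → (d * x) * (e * y) ≡ d * (e * (x * y))
      regroup = solve-∀
      coincide : ∀ u v x y → ∑[ z < n ] ((δ u z * x) * (δ v z * y)) ≡ δ u v * (x * y)
      coincide u v x y = begin
        ∑[ z < n ] ((δ u z * x) * (δ v z * y)) ≡⟨ sum-cong-≗ (λ z → regroup (δ u z) (δ v z) x y) ⟩
        ∑[ z < n ] (δ u z * (δ v z * (x * y))) ≡⟨ ∑-δ u (λ z → δ v z * (x * y)) ⟩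
        δ v u * (x * y)                       ≡⟨ cong₂ _*_ (δ-sym v u) refl ⟩
        δ u v * (x * y)                       ∎

    rep-supported : ∀ z → rep op z ≡ χ (image₂ op A B) z * rep op z
    rep-supported z = 𝟙-absorb (z ∈? image₂ op A B) λ z∉I →
      ∑-zero (λ a → sum λ b → δ (op a b) z * weight a b) λ a →
      ∑-zero (λ b → δ (op a b) z * weight a b) λ b → vanish z∉I a b
      where
      vanish : ¬ z ∈ image₂ op A B → ∀ a b → 𝟙 (op a b ≟ z) * (𝟙 (a ∈? A) * 𝟙 (b ∈? B)) ≡ 0
      vanish z∉I a b with op a b ≟ z | a ∈? A | b ∈? B
      ... | yes refl | yes a∈A | yes b∈B = ⊥-elim (z∉I (∈-image₂ op a∈A b∈B))
      ... | no _     | _       | _       = refl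
      ... | yes _    | no _    | _       = refl
      ... | yes _    | yes _   | no _    = refl

    energy-bound : (∣ A ∣ * ∣ B ∣) * (∣ A ∣ * ∣ B ∣) ≤ ∣ image₂ op A B ∣ * energy op
    energy-bound = begin
      (∣ A ∣ * ∣ B ∣) * (∣ A ∣ * ∣ B ∣)
        ≡⟨ sym (cong₂ _*_ ∑-rep ∑-rep) ⟩
      sum (rep op) * sum (rep op)
        ≡⟨ cong₂ _*_ (sum-cong-≗ rep-supported) (sum-cong-≗ rep-supported) ⟩
      (∑[ z < n ] (χ I z * rep op z)) * (∑[ z < n ] (χ I z * rep op z))
        ≤⟨ cauchy-schwarz (χ I) (rep op) ⟩
      (∑[ z < n ] (χ I z * χ I z)) * (∑[ z < n ] (rep op z * rep op z))
        ≡⟨ cong₂ _*_ (trans (sum-cong-≗ λ z → 𝟙-idem (z ∈? I)) (sym (card I))) ∑-rep² ⟩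
      ∣ I ∣ * energy op ∎
      where
      open ≤-Reasoning
      I : Subset n
      I = image₂ op A B

module Lines {q : ℕ} (F : FiniteField q) where

  open import Level using (0ℓ)
  open import Algebra.Bundles using (CommutativeRing)
  open import Data.Product using (proj₁; proj₂)
  open import Relation.Binary.PropositionalEquality using (refl; sym; trans; cong; module ≡-Reasoning)
  open ≡-Reasoning

  commutativeRing : CommutativeRing 0ℓ 0ℓ
  commutativeRing = record { isCommutativeRing = FiniteField.isCommutativeRing F }

  open FiniteField F using (0≢1; inverse)
  open CommutativeRing commutativeRing
    using (_+_; _-_; -_; 0#; 1#; ring; +-comm; +-assoc; +-identityˡ; -‿inverseˡ; *-comm; *-assoc; *-identityˡ)
    renaming (_*_ to _·_)
  open import Algebra.Properties.Ring ring using (+-cancelˡ; +-cancelʳ; x≈z//y; xyx⁻¹≈y; x∙y⁻¹≈ε⇒x≈y; x[y-z]≈xy-xz)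

  line⁺ line⁻ : Fin q → Fin q → Fin q → Fin q
  line⁺ ξ a b = a + ξ · b
  line⁻ ξ a b = a - ξ · b

  1≢0 : ¬ 1# ≡ 0#
  1≢0 1≡0 = 0≢1 (sym 1≡0)

  ·-cancelˡ : ∀ {c x y} → ¬ c ≡ 0# → c · x ≡ c · y → x ≡ y
  ·-cancelˡ {c} {x} {y} c≢0 cx≡cy = begin
    x              ≡⟨ sym (undo x) ⟩
    c⁻¹ · (c · x)  ≡⟨ cong (c⁻¹ ·_) cx≡cy ⟩
    c⁻¹ · (c · y)  ≡⟨ undo y ⟩
    y              ∎
    where
    c⁻¹ : Fin q
    c⁻¹ = proj₁ (inverse c c≢0)
    undo : ∀ t → c⁻¹ · (c · t) ≡ t
    undo t = begin
      c⁻¹ · (c · t)  ≡⟨ sym (*-assoc c⁻¹ c t) ⟩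
      (c⁻¹ · c) · t  ≡⟨ cong (_· t) (trans (*-comm c⁻¹ c) (proj₂ (inverse c c≢0))) ⟩
      1# · t         ≡⟨ *-identityˡ t ⟩
      t              ∎

  difference-swap : ∀ {u v u' v'} → u + v ≡ u' + v' → u - u' ≡ v' - v
  difference-swap {u} {v} {u'} {v'} e = x≈z//y (u - u') v v' (begin
    (u - u') + v     ≡⟨ +-assoc u (- u') v ⟩
    u + (- u' + v)   ≡⟨ cong (u +_) (+-comm (- u') v) ⟩
    u + (v - u')     ≡⟨ sym (+-assoc u v (- u')) ⟩
    (u + v) - u'     ≡⟨ cong (_- u') e ⟩
    (u' + v') - u'   ≡⟨ xyx⁻¹≈y u' v' ⟩
    v'               ∎)

  -- Adding p + p' to a - p gives a + p'; this converts equations between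
  -- points of A - ξB into equations between points of A + ξB.
  restore : ∀ a p p' → (a - p) + (p + p') ≡ a + p'
  restore a p p' = begin
    (a - p) + (p + p')    ≡⟨ +-assoc a (- p) (p + p') ⟩
    a + (- p + (p + p'))  ≡⟨ cong (a +_) (sym (+-assoc (- p) p p')) ⟩
    a + ((- p + p) + p')  ≡⟨ cong (λ t → a + (t + p')) (-‿inverseˡ p) ⟩
    a + (0# + p')         ≡⟨ cong (a +_) (+-identityˡ p') ⟩
    a + p'                ∎

  module _ {ξ a b a' b' : Fin q} where

    line⁻⇒line⁺ : line⁻ ξ a b ≡ line⁻ ξ a' b' → line⁺ ξ a b' ≡ line⁺ ξ a' b
    line⁻⇒line⁺ e = begin
      a + p'              ≡⟨ sym (restore a p p') ⟩
      (a - p) + (p + p')  ≡⟨ cong (_+ (p + p')) e ⟩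
      (a' - p') + (p + p') ≡⟨ cong ((a' - p') +_) (+-comm p p') ⟩
      (a' - p') + (p' + p) ≡⟨ restore a' p' p ⟩
      a' + p              ∎
      where
      p p' : Fin q
      p  = ξ · b
      p' = ξ · b'

    line⁺⇒line⁻ : line⁺ ξ a b' ≡ line⁺ ξ a' b → line⁻ ξ a b ≡ line⁻ ξ a' b'
    line⁺⇒line⁻ e = +-cancelʳ (p + p') (a - p) (a' - p') (begin
      (a - p) + (p + p')   ≡⟨ restore a p p' ⟩
      a + p'               ≡⟨ e ⟩
      a' + p               ≡⟨ sym (restore a' p' p) ⟩
      (a' - p') + (p' + p) ≡⟨ cong ((a' - p') +_) (+-comm p' p) ⟩
      (a' - p') + (p + p') ∎)
      where
      p p' : Fin q
      p  = ξ · b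
      p' = ξ · b'

    line⁺-intercept : b ≡ b' → line⁺ ξ a b ≡ line⁺ ξ a' b' → a ≡ a'
    line⁺-intercept refl e = +-cancelʳ (ξ · b) a a' e

    line⁺-slope : ¬ ξ ≡ 0# → a ≡ a' → line⁺ ξ a b ≡ line⁺ ξ a' b' → b ≡ b'
    line⁺-slope ξ≢0 refl e = ·-cancelˡ ξ≢0 (+-cancelˡ a (ξ · b) (ξ · b') e)

  lines-meet-once : ∀ {a b a' b' x y} → ¬ b ≡ b' →
    line⁺ x a b ≡ line⁺ x a' b' → line⁺ y a b ≡ line⁺ y a' b' → x ≡ y
  lines-meet-once {a} {b} {a'} {b'} {x} {y} b≢b' ex ey = ·-cancelˡ d≢0 (begin
    d · x   ≡⟨ *-comm d x ⟩
    x · d   ≡⟨ meeting-point x ex ⟩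
    a - a'  ≡⟨ sym (meeting-point y ey) ⟩
    y · d   ≡⟨ *-comm y d ⟩
    d · y   ∎)
    where
    d : Fin q
    d = b' - b
    d≢0 : ¬ d ≡ 0#
    d≢0 d≡0 = b≢b' (sym (x∙y⁻¹≈ε⇒x≈y b' b d≡0))
    meeting-point : ∀ t → line⁺ t a b ≡ line⁺ t a' b' → t · d ≡ a - a'
    meeting-point t e = trans (x[y-z]≈xy-xz t b' b) (sym (difference-swap e))

module Arithmetic where

  open import Data.Nat using (zero; suc; _+_; _≤_)
  open import Data.Nat.Properties
    using (≤-pred; m<m+n; m≤m+n; +-mono-≤; +-monoʳ-≤; *-monoʳ-≤; *-monoˡ-≤; *-monoʳ-<; *-assoc;
           *-zeroʳ; +-cancelʳ-≡; <⇒≱; ≰⇒>; module ≤-Reasoning)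
  open import Data.Nat.Tactic.RingSolver using (solve-∀)
  open import Relation.Binary.PropositionalEquality using (sym; trans; cong; subst)
  open ≤-Reasoning

  large-image : ∀ {q E N I} → q * E < 2 * N → N ≤ I * E → q < 2 * I
  large-image {q} {E} {N} {I} qE<2N N≤IE = ≰⇒> λ 2I≤q → <⇒≱ qE<2N (begin
    2 * N        ≤⟨ *-monoʳ-≤ 2 N≤IE ⟩
    2 * (I * E)  ≡⟨ sym (*-assoc 2 I E) ⟩
    2 * I * E    ≤⟨ *-monoˡ-≤ E 2I≤q ⟩
    q * E        ∎)

  -- The core inequality in the variables m = M - 1, k = K - 1.
  core-inequality : ∀ Z m k → 1 ≤ Z → m ≤ Z → suc Z < suc m * suc k →
    suc Z * (m * k + Z) < 2 * Z * (suc m * suc k)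
  core-inequality Z m k 1≤Z m≤Z Z<N = begin-strict
    suc Z * (m * k + Z)                     ≡⟨ expand-left Z m k ⟩
    Z * (m * k) + Z * suc Z + m * k         ≤⟨ +-mono-≤ (+-monoʳ-≤ (Z * (m * k)) (*-monoʳ-≤ Z Z<mk+m+k))
                                                        (*-monoˡ-≤ k m≤Z) ⟩
    Z * (m * k) + Z * (m * k + m + k) + Z * k   <⟨ m<m+n _ 1≤Z ⟩
    Z * (m * k) + Z * (m * k + m + k) + Z * k + Z
                                            ≤⟨ m≤m+n _ (Z * m + Z) ⟩
    Z * (m * k) + Z * (m * k + m + k) + Z * k + Z + (Z * m + Z)
                                            ≡⟨ expand-right Z m k ⟩
    2 * Z * (suc m * suc k)                 ∎
    where
    expand-N : ∀ m k → suc m * suc k ≡ suc (m * k + m + k)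
    expand-N = solve-∀
    Z<mk+m+k : suc Z ≤ m * k + m + k
    Z<mk+m+k = ≤-pred (subst (suc (suc Z) ≤_) (expand-N m k) Z<N)
    expand-left : ∀ Z m k → suc Z * (m * k + Z) ≡ Z * (m * k) + Z * suc Z + m * k
    expand-left = solve-∀
    expand-right : ∀ Z m k →
      Z * (m * k) + Z * (m * k + m + k) + Z * k + Z + (Z * m + Z) ≡ 2 * Z * (suc m * suc k)
    expand-right = solve-∀

  -- With q = Z + 1, N = M·K > q, M ≤ q, and the off-diagonal counts
  -- M_A = M² - M, M_B = K² - K:  q·(M_A·M_B + Z·N) < Z·2N².
  averaging-inequality : ∀ Z M K MA MB → 1 ≤ Z → M ≤ suc Z →
    MA + M ≡ M * M → MB + K ≡ K * K → suc Z < M * K →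
    suc Z * (MA * MB + Z * (M * K)) < Z * (2 * ((M * K) * (M * K)))
  averaging-inequality Z zero    K       MA MB _ _ _ _ ()
  averaging-inequality Z (suc m) zero    MA MB _ _ _ _ Z<N with () ← subst (suc Z <_) (*-zeroʳ (suc m)) Z<N
  averaging-inequality Z (suc m) (suc k) MA MB 1≤Z M≤q MA+M MB+K Z<N = begin-strict
    suc Z * (MA * MB + Z * N)             ≡⟨ cong (λ t → suc Z * (t * MB + Z * N)) MA≡Mm ⟩
    suc Z * (suc m * m * MB + Z * N)      ≡⟨ cong (λ t → suc Z * (suc m * m * t + Z * N)) MB≡Kk ⟩
    suc Z * (suc m * m * (suc k * k) + Z * N) ≡⟨ factor-left Z m k ⟩
    N * (suc Z * (m * k + Z))             <⟨ *-monoʳ-< N (core-inequality Z m k 1≤Z (≤-pred M≤q) Z<N) ⟩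
    N * (2 * Z * N)                       ≡⟨ factor-right Z N ⟩
    Z * (2 * (N * N))                     ∎
    where
    N : ℕ
    N = suc m * suc k
    square : ∀ m → suc m * suc m ≡ suc m * m + suc m
    square = solve-∀
    MA≡Mm : MA ≡ suc m * m
    MA≡Mm = +-cancelʳ-≡ (suc m) MA (suc m * m) (trans MA+M (square m))
    MB≡Kk : MB ≡ suc k * k
    MB≡Kk = +-cancelʳ-≡ (suc k) MB (suc k * k) (trans MB+K (square k))
    factor-left : ∀ Z m k →
      suc Z * (suc m * m * (suc k * k) + Z * (suc m * suc k)) ≡ (suc m * suc k) * (suc Z * (m * k + Z))
    factor-left = solve-∀
    factor-right : ∀ Z N → N * (2 * Z * N) ≡ Z * (2 * (N * N))
    factor-right = solve-∀

-- A quadruple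
-- (a, b, a', b') with a + ξb = a' + ξb' is counted for every nonzero ξ
-- if (a, b) = (a', b'), for no ξ if exactly one of a = a', b = b' holds,
-- and for at most one ξ otherwise; hence
--   ∑_{ξ≠0} E(A + ξB) ≤ (|A|² - |A|)(|B|² - |B|) + (q - 1)|A||B|.
-- Comparing with (q - 1)·2(|A||B|)²/q shows that some nonzero ξ has
-- q·E(A + ξB) < 2(|A||B|)².
module SlopeAveraging {q : ℕ} (F : FiniteField q) (A B : Subset q) where

  open import Data.Nat using (suc; _+_; _≤_; z≤n; _<?_)
  open import Data.Nat.Properties
    using (+-comm; *-identityʳ; *-assoc; *-monoˡ-≤; *-monoʳ-≤; *-mono-≤; m≤m+n;
           m*n≡1⇒n≡1; ≤-trans; ≤-reflexive; <⇒≱; ≮⇒≥; module ≤-Reasoning)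
  open import Data.Nat.Tactic.RingSolver using (solve-∀)
  open import Data.Fin.Properties using (_≟_; any?)
  open import Data.Fin.Subset.Properties using (_∈?_; ∣p∣≤n)
  open import Data.Product using (_,_)
  open import Data.Empty using (⊥-elim)
  open import Function using (_∘_)
  open import Relation.Nullary using (yes; no; ¬?)
  open import Relation.Nullary.Decidable using (_×-dec_)
  open import Relation.Binary.PropositionalEquality using (refl; sym; trans; cong; cong₂; subst; module ≡-Reasoning)
  open Indicators
  open FiniteSums
  open Lines F
  open AdditiveEnergy A B
  open Arithmetic
  open FiniteField F using (0#; 1#)

  N : ℕ
  N = ∣ A ∣ * ∣ B ∣

  nonzero : Fin q → ℕ
  nonzero ξ = δᶜ ξ 0#

  #nonzero : ℕ
  #nonzero = sum nonzero

  suc-#nonzero : suc #nonzero ≡ q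
  suc-#nonzero = begin
    suc #nonzero                                 ≡⟨ +-comm 1 #nonzero ⟩
    #nonzero + 1                                 ≡⟨ cong (#nonzero +_) (sym one-zero) ⟩
    #nonzero + ∑[ ξ < q ] δ ξ 0#                 ≡⟨ sym (∑-distrib-+ nonzero (λ ξ → δ ξ 0#)) ⟩
    ∑[ ξ < q ] (nonzero ξ + δ ξ 0#)              ≡⟨ sum-cong-≗ (λ ξ → 𝟙-¬ (ξ ≟ 0#)) ⟩
    ∑[ ξ < q ] 1                                 ≡⟨ ∑-ones q ⟩
    q                                            ∎
    where
    open ≡-Reasoning
    one-zero : ∑[ ξ < q ] δ ξ 0# ≡ 1
    one-zero = trans (sum-cong-≗ λ ξ → trans (δ-sym ξ 0#) (sym (*-identityʳ (δ 0# ξ)))) (∑-δ 0# (λ _ → 1))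

  1≤#nonzero : 1 ≤ #nonzero
  1≤#nonzero = ≤-trans (≤-reflexive (sym (𝟙-yes 1≢0 (¬? (1# ≟ 0#))))) (∑-term nonzero 1#)

  coincidences : Fin q → Fin q → Fin q → Fin q → ℕ
  coincidences a b a' b' = ∑[ ξ < q ] (nonzero ξ * δ (line⁺ ξ a b) (line⁺ ξ a' b'))

  never : ∀ {a b a' b'} → (∀ ξ → ¬ ξ ≡ 0# → ¬ line⁺ ξ a b ≡ line⁺ ξ a' b') → coincidences a b a' b' ≡ 0
  never {a} {b} {a'} {b'} apart = ∑-zero (λ ξ → nonzero ξ * δ (line⁺ ξ a b) (line⁺ ξ a' b')) λ ξ →
    𝟙-guard (¬? (ξ ≟ 0#)) λ ξ≢0 → 𝟙-no (apart ξ ξ≢0) (line⁺ ξ a b ≟ line⁺ ξ a' b')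

  -- Every nonzero ξ for equal pairs, none if exactly one coordinate agrees,
  -- at most one if both differ.  (After the case split the indicators on
  -- the right-hand side have already been evaluated.)
  coincidences-bound : ∀ a b a' b' →
    coincidences a b a' b' ≤ δᶜ a a' * δᶜ b b' + #nonzero * (δ a a' * δ b b')
  coincidences-bound a b a' b' with a ≟ a' | b ≟ b'
  ... | yes refl | yes refl = ≤-trans (∑-mono at-most-nonzero) (≤-reflexive (sym (*-identityʳ #nonzero)))
    where
    at-most-nonzero : ∀ ξ → nonzero ξ * δ (line⁺ ξ a b) (line⁺ ξ a b) ≤ nonzero ξ
    at-most-nonzero ξ = ≤-trans (*-monoʳ-≤ (nonzero ξ) (𝟙≤1 (line⁺ ξ a b ≟ line⁺ ξ a b)))
                                (≤-reflexive (*-identityʳ (nonzero ξ)))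
  ... | no a≢a'  | yes refl = ≤-trans (≤-reflexive (never λ ξ ξ≢0 → a≢a' ∘ line⁺-intercept refl)) z≤n
  ... | yes refl | no b≢b'  = ≤-trans (≤-reflexive (never λ ξ ξ≢0 → b≢b' ∘ line⁺-slope ξ≢0 refl)) z≤n
  ... | no a≢a'  | no b≢b'  = ≤-trans at-most-one (m≤m+n 1 (#nonzero * 0))
    where
    meet : ∀ ξ → nonzero ξ * δ (line⁺ ξ a b) (line⁺ ξ a' b') ≡ 1 → line⁺ ξ a b ≡ line⁺ ξ a' b'
    meet ξ e = 𝟙≡1⇒ (line⁺ ξ a b ≟ line⁺ ξ a' b') (m*n≡1⇒n≡1 (nonzero ξ) _ e)
    at-most-one : coincidences a b a' b' ≤ 1
    at-most-one = ∑-at-most-one (λ ξ → nonzero ξ * δ (line⁺ ξ a b) (line⁺ ξ a' b'))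
      (λ ξ → *-mono-≤ (𝟙≤1 (¬? (ξ ≟ 0#))) (𝟙≤1 (line⁺ ξ a b ≟ line⁺ ξ a' b')))
      (λ ξ ζ eξ eζ → lines-meet-once b≢b' (meet ξ eξ) (meet ζ eζ))

  off-diagonal : Subset q → ℕ
  off-diagonal P = ∑₂ λ x y → δᶜ x y * (χ P x * χ P y)

  diagonal : ∀ P → ∑₂ (λ x y → δ x y * (χ P x * χ P y)) ≡ ∣ P ∣
  diagonal P = begin
    ∑₂ (λ x y → δ x y * (χ P x * χ P y))  ≡⟨ ∑₂-diagonal (λ x y → χ P x * χ P y) ⟩
    ∑[ x < q ] (χ P x * χ P x)            ≡⟨ sum-cong-≗ (λ x → 𝟙-idem (x ∈? P)) ⟩
    sum (χ P)                             ≡⟨ sym (card P) ⟩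
    ∣ P ∣                                 ∎
    where open ≡-Reasoning

  off-diagonal+size : ∀ P → off-diagonal P + ∣ P ∣ ≡ ∣ P ∣ * ∣ P ∣
  off-diagonal+size P = begin
    off-diagonal P + ∣ P ∣                                   ≡⟨ cong (off-diagonal P +_) (sym (diagonal P)) ⟩
    off-diagonal P + ∑₂ (λ x y → δ x y * (χ P x * χ P y))   ≡⟨ ∑₂-split-diagonal (λ x y → χ P x * χ P y) ⟩
    ∑₂ (λ x y → χ P x * χ P y)                              ≡⟨ sym (∑-product (χ P) (χ P)) ⟩
    sum (χ P) * sum (χ P)                                   ≡⟨ sym (cong₂ _*_ (card P) (card P)) ⟩
    ∣ P ∣ * ∣ P ∣                                           ∎
    where open ≡-Reasoning

  energy⁺ : Fin q → ℕ
  energy⁺ ξ = energy (line⁺ ξ)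

  averaged-energy : ∑[ ξ < q ] (nonzero ξ * energy⁺ ξ) ≤ off-diagonal A * off-diagonal B + #nonzero * N
  averaged-energy = begin
    ∑[ ξ < q ] (nonzero ξ * energy⁺ ξ)
      ≡⟨ sum-cong-≗ (λ ξ → *-∑₄ (nonzero ξ) (λ a b a' b' → D ξ a b a' b' * W a b a' b')) ⟩
    ∑[ ξ < q ] ∑₄ (λ a b a' b' → nonzero ξ * (D ξ a b a' b' * W a b a' b'))
      ≡⟨ ∑-∑₄ (λ ξ a b a' b' → nonzero ξ * (D ξ a b a' b' * W a b a' b')) ⟩
    ∑₄ (λ a b a' b' → ∑[ ξ < q ] (nonzero ξ * (D ξ a b a' b' * W a b a' b')))
      ≡⟨ ∑₄-cong count ⟩
    ∑₄ (λ a b a' b' → coincidences a b a' b' * W a b a' b')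
      ≤⟨ ∑₄-mono (λ a b a' b' → *-monoˡ-≤ (W a b a' b') (coincidences-bound a b a' b')) ⟩
    ∑₄ (λ a b a' b' → (δᶜ a a' * δᶜ b b' + #nonzero * (δ a a' * δ b b')) * W a b a' b')
      ≡⟨ ∑₄-cong (λ a b a' b' → separate (δᶜ a a') (δᶜ b b') (δ a a') (δ b b')
                                         (χ A a) (χ B b) (χ A a') (χ B b') #nonzero) ⟩
    ∑₄ (λ a b a' b' → off A a a' * off B b b' + #nonzero * (diag A a a' * diag B b b'))
      ≡⟨ ∑₄-distrib-+ (λ a b a' b' → off A a a' * off B b b')
                      (λ a b a' b' → #nonzero * (diag A a a' * diag B b b')) ⟩
    ∑₄ (λ a b a' b' → off A a a' * off B b b') + ∑₄ (λ a b a' b' → #nonzero * (diag A a a' * diag B b b'))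
      ≡⟨ cong₂ _+_ (∑₄-factor (off A) (off B))
                   (trans (sym (*-∑₄ #nonzero (λ a b a' b' → diag A a a' * diag B b b')))
                          (cong (#nonzero *_) (∑₄-factor (diag A) (diag B)))) ⟩
    off-diagonal A * off-diagonal B + #nonzero * (∑₂ (diag A) * ∑₂ (diag B))
      ≡⟨ cong (λ t → off-diagonal A * off-diagonal B + #nonzero * t) (cong₂ _*_ (diagonal A) (diagonal B)) ⟩
    off-diagonal A * off-diagonal B + #nonzero * N ∎
    where
    open ≤-Reasoning
    D : Fin q → Fin q → Fin q → Fin q → Fin q → ℕ
    D ξ a b a' b' = δ (line⁺ ξ a b) (line⁺ ξ a' b')
    W : Fin q → Fin q → Fin q → Fin q → ℕ
    W a b a' b' = weight a b * weight a' b'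
    off diag : Subset q → Fin q → Fin q → ℕ
    off  P x y = δᶜ x y * (χ P x * χ P y)
    diag P x y = δ x y * (χ P x * χ P y)
    count : ∀ a b a' b' → ∑[ ξ < q ] (nonzero ξ * (D ξ a b a' b' * W a b a' b'))
                           ≡ coincidences a b a' b' * W a b a' b'
    count a b a' b' = trans (sum-cong-≗ λ ξ → sym (*-assoc (nonzero ξ) (D ξ a b a' b') (W a b a' b')))
                            (sym (∑-* (W a b a' b') λ ξ → nonzero ξ * D ξ a b a' b'))
    separate : ∀ s t u v x y x' y' Z →
      (s * t + Z * (u * v)) * ((x * y) * (x' * y'))
        ≡ (s * (x * x')) * (t * (y * y')) + Z * ((u * (x * x')) * (v * (y * y')))
    separate = solve-∀

  -- The energy of A - ξB equals that of A + ξB: exchange b and b'.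
  energy⁻≡energy⁺ : ∀ ξ → energy (line⁻ ξ) ≡ energy⁺ ξ
  energy⁻≡energy⁺ ξ = begin
    energy (line⁻ ξ)
      ≡⟨ ∑₄-cong (λ a b a' b' → cong₂ _*_
           (𝟙-cong line⁻⇒line⁺ line⁺⇒line⁻ (line⁻ ξ a b ≟ line⁻ ξ a' b') (line⁺ ξ a b' ≟ line⁺ ξ a' b))
           (exchange (χ A a) (χ B b) (χ A a') (χ B b'))) ⟩
    ∑₄ (λ a b a' b' → δ (line⁺ ξ a b') (line⁺ ξ a' b) * (weight a b' * weight a' b))
      ≡⟨ sym (∑₄-swap (λ a b a' b' → δ (line⁺ ξ a b) (line⁺ ξ a' b') * (weight a b * weight a' b'))) ⟩
    energy⁺ ξ ∎
    where
    open ≡-Reasoning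
    exchange : ∀ x y x' y' → (x * y) * (x' * y') ≡ (x * y') * (x' * y)
    exchange = solve-∀

  low-energy-slope : q < N → Σ (Fin q) λ ξ → ¬ ξ ≡ 0# × q * energy⁺ ξ < 2 * (N * N)
  low-energy-slope q<N with any? (λ ξ → ¬? (ξ ≟ 0#) ×-dec (q * energy⁺ ξ <? 2 * (N * N)))
  ... | yes found = found
  ... | no none   = ⊥-elim (<⇒≱ too-small total)
    where
    open ≤-Reasoning
    bound : ℕ
    bound = off-diagonal A * off-diagonal B + #nonzero * N
    high : ∀ ξ → ¬ ξ ≡ 0# → 2 * (N * N) ≤ q * energy⁺ ξ
    high ξ ξ≢0 = ≮⇒≥ λ low → none (ξ , ξ≢0 , low)
    reorder : ∀ x q e → x * (q * e) ≡ q * (x * e)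
    reorder = solve-∀
    total : #nonzero * (2 * (N * N)) ≤ q * bound
    total = begin
      #nonzero * (2 * (N * N))                   ≡⟨ ∑-* (2 * (N * N)) nonzero ⟩
      ∑[ ξ < q ] (nonzero ξ * (2 * (N * N)))     ≤⟨ ∑-mono (λ ξ → 𝟙-weighted-≤ (high ξ) (¬? (ξ ≟ 0#))) ⟩
      ∑[ ξ < q ] (nonzero ξ * (q * energy⁺ ξ))   ≡⟨ sum-cong-≗ (λ ξ → reorder (nonzero ξ) q (energy⁺ ξ)) ⟩
      ∑[ ξ < q ] (q * (nonzero ξ * energy⁺ ξ))   ≡⟨ sym (*-∑ q (λ ξ → nonzero ξ * energy⁺ ξ)) ⟩
      q * ∑[ ξ < q ] (nonzero ξ * energy⁺ ξ)     ≤⟨ *-monoʳ-≤ q averaged-energy ⟩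
      q * bound                                  ∎
    too-small : q * bound < #nonzero * (2 * (N * N))
    too-small = subst (λ t → t * bound < #nonzero * (2 * (N * N))) suc-#nonzero
      (averaging-inequality #nonzero ∣ A ∣ ∣ B ∣ (off-diagonal A) (off-diagonal B) 1≤#nonzero
        (subst (∣ A ∣ ≤_) (sym suc-#nonzero) (∣p∣≤n A))
        (off-diagonal+size A) (off-diagonal+size B)
        (subst (_< N) (sym suc-#nonzero) q<N))

lemma2 : (q : ℕ) (F : FiniteField q) (A B : Subset q) →
    q < ∣ A ∣ * ∣ B ∣ →
    Σ (Fin q) λ ξ → ¬ (ξ ≡ FiniteField.0# F) ×
    (q < 2 * ∣ (F +[ ξ ] A) B ∣ × q < 2 * ∣ (F -[ ξ ] A) B ∣)
lemma2 q F A B q<N =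
  let ξ , ξ≢0 , low-energy = low-energy-slope q<N in
  ξ , ξ≢0 ,
  large-image {I = ∣ (F +[ ξ ] A) B ∣} low-energy (energy-bound (line⁺ ξ)) ,
  large-image {I = ∣ (F -[ ξ ] A) B ∣} (subst (λ e → q * e < 2 * (N * N)) (sym (energy⁻≡energy⁺ ξ)) low-energy)
              (energy-bound (line⁻ ξ))
  where
  open import Data.Product using (_,_)
  open import Relation.Binary.PropositionalEquality using (sym; subst)
  open Lines F using (line⁺; line⁻)
  open AdditiveEnergy A B using (energy-bound)
  open SlopeAveraging F A B using (N; low-energy-slope; energy⁻≡energy⁺)
  open Arithmetic using (large-image)
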